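{- Let $p$ be a prime and let $(\Omega,S)$ be a coherent configuration with fibers $\Omega_1,\dots,\Omega_m$ such that $(\Omega_i,S_i)\simeq C_p\wr C_p$ for each $i$, $n_s=p$ for each $s\in\bigcup_{i\ne j}S_{ij}$, and $S=\bigcup_{i=1}^mS_i\cup(S\setminus R)$ where $R$ is the set of regular elements of $S$. Fix $\alpha_i\in\Omega_i$ ($1\le i\le m$), $t_1\in\mathbf{O}_\theta(S_1)\setminus\{1_{\Omega_1}\}$, and for $i\ge2$ let $t_i$ be the unique element of $\mathbf{O}_\theta(S_i)$ with $r(\alpha_1t_1,\alpha_it_i)=r(\alpha_1,\alpha_i)$. For each $i$ let $\{\alpha_{ik}\mid k=1,\dots,p\}$ be a complete set of representatives of the equivalence relation $\bigcup_{t\in\mathbf{O}_\theta(S_i)}t$ on $\Omega_i$. For $s\in S_{ij}$ with $i\ne j$ and $k,l\in\{1,\dots,p\}$ let $h(s)_{kl}\in\mathbb{Z}_p$ be the unique element with $r(\alpha_{ik},\alpha_{jl}t_j^{h(s)_{kl}})=s$. Then for each such $s$ and all $k,l$, \[s\cap\bigl(\alpha_{ik}\mathbf{O}_\theta(S_i)\times\alpha_{jl}\mathbf{O}_\theta(S_j)\bigr)=\{(\alpha_{ik}t_i^a,\alpha_{jl}t_j^b)\mid a,b\in\mathbb{Z}_p,\ b-a=h(s)_{kl}\}.\]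
   Context: A coherent configuration is a pair $(\Omega,S)$ of a finite set $\Omega$ and a partition $S$ of $\Omega\times\Omega$ such that $1_\Omega$ is a union of elements of $S$, $s^\ast:=\{(\beta,\alpha)\mid(\alpha,\beta)\in s\}\in S$ for $s\in S$, and $\sigma_s\sigma_t=\sum_{u\in S}c_{st}^u\sigma_u$ with nonnegative integers $c_{st}^u$, where $\sigma_u$ is the adjacency matrix of $u$. Fibers are the sets $\Delta$ with $1_\Delta\in S$; they partition $\Omega$. $S_{ij}:=\{s\in S\mid s\subseteq\Omega_i\times\Omega_j\}$, $S_i:=S_{ii}$. For $s\in S_{ij}$, $n_s:=|\{\beta\mid(\alpha,\beta)\in s\}|$ for any $\alpha\in\Omega_i$. $\mathbf{O}_\theta(S_i):=\{t\in S_i\mid n_t=1\}$, a cyclic group of order $p$ under relational composition; for $u\in\mathbf{O}_\theta(S_i)$ and $\beta\in\Omega_i$, $\beta u$ is the unique $\gamma$ with $(\beta,\gamma)\in u$, $t_i^a$ is the $a$-fold composition, and $\beta\mathbf{O}_\theta(S_i):=\{\beta u\mid u\in\mathbf{O}_\theta(S_i)\}$. $r(\alpha,\beta)$ is the unique element of $S$ containing $(\alpha,\beta)$. An element $s$ is regular if $ss^\ast s=\{s\}$, using the complex product $TU:=\{s\mid c_{tu}^s>0$ for some $t\in T,u\in U\}$. $C_p\wr C_p$ is the association scheme on $\mathbb{Z}_p\times\mathbb{Z}_p$ with relations $\{((x,y),(x+a,y))\}$ ($a\in\mathbb{Z}_p$) and $\{((x_1,y),(x_2,y+b))\}$ ($b\ne0$).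 -}

module Defs where

open import Data.Nat using (ℕ; zero; suc; _+_)
open import Data.Fin using (Fin; toℕ; _≟_)
open import Data.List using (List; filter; length)
open import Data.List using () renaming (allFin to allFinL)
open import Data.Product using (Σ; _×_; _,_; ∃; ∃-syntax)
open import Data.Sum using (_⊎_)
open import Data.Integer using (ℤ; +_; _-_)
open import Data.Integer.Divisibility using () renaming (_∣_ to _∣ℤ_)
open import Relation.Binary.PropositionalEquality using (_≡_; _≢_)
open import Relation.Nullary using (Dec; ¬_)
open import Relation.Nullary.Decidable using (_×-dec_)
open import Relation.Unary using (Pred; Decidable)
open import Level using (0ℓ)

countFin : (N : ℕ) → (P : Pred (Fin N) 0ℓ) → Decidable P → ℕ
countFin N P P? = length (filter P? (allFinL N))

_≡[mod_]_ : ℕ → ℕ → ℕ → Set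
x ≡[mod p ] y = (+ p) ∣ℤ ((+ x) - (+ y))

-- The relations of C_p ≀ C_p on ℤ_p × ℤ_p (elements (x , y)):
--   {((x,y),(x+a,y))}  (a ∈ ℤ_p)   and   {((x₁,y),(x₂,y+b))}  (b ≠ 0).
-- SameWr p P Q P' Q' : (P,Q) and (P',Q') lie in the same relation.

SameWr : (p : ℕ) → Fin p × Fin p → Fin p × Fin p →
         Fin p × Fin p → Fin p × Fin p → Set
SameWr p (x₁ , y₁) (x₂ , y₂) (x₃ , y₃) (x₄ , y₄) =
  (y₁ ≡ y₂ × y₃ ≡ y₄ × (toℕ x₂ + toℕ x₃) ≡[mod p ] (toℕ x₄ + toℕ x₁))
  ⊎ (y₁ ≢ y₂ × y₃ ≢ y₄ × (toℕ y₂ + toℕ y₃) ≡[mod p ] (toℕ y₄ + toℕ y₁))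

-- The partition S of Ω × Ω is
-- given by a surjective colouring  r : Ω → Ω → Fin K ; the colour class
-- of c is the element of S, and r α β is the element of S containing
-- (α, β).

record CoherentConfiguration (N K : ℕ) : Set where
  field
    r : Fin N → Fin N → Fin K
    surj : ∀ (s : Fin K) → ∃[ α ] ∃[ β ] (r α β ≡ s)
    -- 1_Ω is a union of elements of S
    diag : ∀ α β γ → r α α ≡ r β γ → β ≡ γ
    -- s* ∈ S for s ∈ S
    conv : ∀ α β γ δ → r α β ≡ r γ δ → r β α ≡ r δ γ
    -- σ_s σ_t = Σ_u c_st^u σ_u : the number of γ with (α,γ) ∈ s and
    -- (γ,β) ∈ t depends only on the colour of (α,β)
    coh : ∀ (s t : Fin K) α β α' β' → r α β ≡ r α' β' →
          countFin N (λ γ → r α γ ≡ s × r γ β ≡ t)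
                     (λ γ → (r α γ ≟ s) ×-dec (r γ β ≟ t))
          ≡ countFin N (λ γ → r α' γ ≡ s × r γ β' ≡ t)
                     (λ γ → (r α' γ ≟ s) ×-dec (r γ β' ≟ t))

module CC {N K : ℕ} (C : CoherentConfiguration N K) where
  open CoherentConfiguration C

  -- n_s = k : every α having an s-successor has exactly k of them
  -- (for s ∈ S_ij this is the number of β with (α,β) ∈ s, α ∈ Ω_i).
  valency : Fin K → ℕ → Set
  valency s k = ∀ α → (∃[ β ] (r α β ≡ s)) →
                countFin N (λ β → r α β ≡ s) (λ β → r α β ≟ s) ≡ k

  cpos : Fin K → Fin K → Fin K → Set
  cpos s t u = ∃[ α ] ∃[ β ] (r α β ≡ u × ∃[ γ ] (r α γ ≡ s × r γ β ≡ t))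

  IsConverse : Fin K → Fin K → Set
  IsConverse s s* = ∀ α β → r α β ≡ s → r β α ≡ s*

  InSS*S : Fin K → Fin K → Set
  InSS*S s u = ∃[ s* ] (IsConverse s s* × ∃[ v ] (cpos s s* v × cpos v s u))

  Regular : Fin K → Set
  Regular s = ∀ u → (InSS*S s u → u ≡ s) × (u ≡ s → InSS*S s u)

  data Pow (u : Fin K) : ℕ → Fin N → Fin N → Set where
    pow0 : ∀ β → Pow u zero β β
    powS : ∀ {a β γ δ} → Pow u a β γ → r γ δ ≡ u → Pow u (suc a) β δ

  -- A labelling of the fibers by Fin m:  fib α = i  iff  α ∈ Ω_i.
  -- Fibers are the sets Δ with 1_Δ ∈ S, i.e. the classes of α ↦ r α α.
  record Fibers (m : ℕ) : Set where
    field
      fib      : Fin N → Fin m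
      fib-surj : ∀ i → ∃[ α ] (fib α ≡ i)
      fib-same : ∀ α β → fib α ≡ fib β → r α α ≡ r β β
      same-fib : ∀ α β → r α α ≡ r β β → fib α ≡ fib β

  module FiberNotions {m : ℕ} (F : Fibers m) where
    open Fibers F

    InS : Fin m → Fin m → Fin K → Set
    InS i j s = ∀ α β → r α β ≡ s → fib α ≡ i × fib β ≡ j

    InO : Fin m → Fin K → Set
    InO i u = InS i i u × valency u 1

    InOrbit : Fin m → Fin N → Fin N → Set
    InOrbit i β γ = ∃[ u ] (InO i u × r β γ ≡ u)

    IsoWr : ℕ → Fin m → Set
    IsoWr p i =
      Σ (Fin N → Fin p × Fin p) λ φ → Σ (Fin p × Fin p → Fin N) λ ψ →
        (∀ z → fib (ψ z) ≡ i) ×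
        (∀ z → φ (ψ z) ≡ z) ×
        (∀ β → fib β ≡ i → ψ (φ β) ≡ β) ×
        (∀ β γ β' γ' → fib β ≡ i → fib γ ≡ i → fib β' ≡ i → fib γ' ≡ i →
           (r β γ ≡ r β' γ' → SameWr p (φ β) (φ γ) (φ β') (φ γ')) ×
           (SameWr p (φ β) (φ γ) (φ β') (φ γ') → r β γ ≡ r β' γ'))

{-# OPTIONS --safe #-}
-- Identify each fibre with ℤ_p × ℤ_p.  The classes of ⋃ O_θ(S_i) are then the blocks
-- {(x , y) | x ∈ ℤ_p}, and each thin element adds a constant to the offset x.  For i ≠ j an
-- element s ∈ S_ij never relates a point to two points of one block: otherwise s absorbs a
-- nontrivial thin element, hence is regular, and regular elements lie in some S_i.
-- The core is that (t_i , t_j) preserves every colour of S_ij.  When fibre 1 is involved this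
-- follows from the defining property of t_i by sliding along blocks, as thin elements commute.
-- For two other fibres, take a point of fibre 1 joined to δ ∈ Ω_j by two paths through Ω_i and
-- translate it p times by (t_1 , t_j); pigeonholing the 2p midpoints into p blocks gives a
-- nonzero e such that (t_i^e , t_j^e) preserves the colour, and e is invertible mod p.
-- Finally β = α_ik t_i^a forces its s-partner in the block of α_jl to be α_jl t_j^(a+h).
module Submission where

open import Defs
open import Level using (0ℓ)
open import Data.Nat using (ℕ; zero; suc; _+_; _*_; _∸_; _≤_; _<_; s≤s; z≤n; NonZero; _%_)
open import Data.Nat.Properties
  using (≤-reflexive; ≤-total; <-irrefl; <-trans; m<m+n; +-comm; +-assoc; +-identityʳ; *-assoc; *-identityʳ;
         *-distribʳ-∸; *-monoˡ-≤; m∸n+n≡m; m+[n∸m]≡n; +-commutativeSemigroup)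
open import Data.Nat.DivMod
  using (_mod_; m%n≤n; m<n⇒m%n≡m; m%n%n≡m%n; n%n≡0; %-distribˡ-+; %-distribˡ-*)
open import Data.Nat.Divisibility using (_∣_; n∣m⇒m%n≡0; m%n≡0⇒n∣m)
open import Data.Nat.Primality using (Prime; euclidsLemma; prime⇒nonZero; prime⇒nonTrivial)
open import Data.Nat.Base using (nonTrivial⇒n>1)
open import Data.Integer as ℤ using (+_; _-_)
import Data.Integer.Properties as ℤ
open import Data.Fin using (Fin; zero; suc; toℕ; inject≤; punchOut; splitAt; join; _≟_)
import Data.Fin.Properties as Fin
open import Data.List using (List; _∷_; filter; lookup; allFin)
open import Data.List.Membership.Propositional using (_∈_)
open import Data.List.Membership.Propositional.Properties using (∈-filter⁺; ∈-filter⁻; ∈-allFin; ∈-lookup)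
open import Data.List.Relation.Unary.Any using (index)
open import Data.List.Relation.Unary.Any.Properties using (lookup-index)
import Data.List.Relation.Unary.All as All
open import Data.List.Relation.Unary.AllPairs using (_∷_)
open import Data.List.Relation.Unary.Unique.Propositional using (Unique)
open import Data.List.Relation.Unary.Unique.Propositional.Properties using (filter⁺; allFin⁺)
open import Data.Product using (Σ; _×_; _,_; ∃; ∃₂; ∃-syntax; proj₁; proj₂)
open import Data.Sum using (_⊎_; inj₁; inj₂)
open import Data.Empty using (⊥-elim)
open import Function.Definitions using (Injective)
open import Relation.Binary.PropositionalEquality
open import Relation.Binary.Bundles using (Setoid)
open import Relation.Binary.Structures using (IsEquivalence)
import Relation.Binary.Reasoning.Setoid as SetoidReasoning
open import Algebra.Properties.CommutativeSemigroup +-commutativeSemigroup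
  using () renaming (xy∙z≈y∙xz to x+y+z≡y+[x+z]; xy∙z≈xz∙y to x+y+z≡x+z+y)
open import Relation.Nullary using (¬_; yes; no)
open import Relation.Unary using (Pred; Decidable)
open import Relation.Nullary.Decidable using (_×-dec_)

lookup-injective : ∀ {A : Set} {xs : List A} → Unique xs → ∀ i j → lookup xs i ≡ lookup xs j → i ≡ j
lookup-injective (_ ∷ _) zero zero _ = refl
lookup-injective {xs = _ ∷ xs} (x∉ ∷ _) zero (suc j) e = ⊥-elim (All.lookup x∉ (∈-lookup {xs = xs} j) e)
lookup-injective {xs = _ ∷ xs} (x∉ ∷ _) (suc i) zero e = ⊥-elim (All.lookup x∉ (∈-lookup {xs = xs} i) (sym e))
lookup-injective (_ ∷ u) (suc i) (suc j) e = cong suc (lookup-injective u i j e)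

module _ {N : ℕ} {P : Pred (Fin N) 0ℓ} (P? : Decidable P) where
  private
    L = filter P? (allFin N)

  ≤countFin⇒injection : ∀ {n} → n ≤ countFin N P P? →
                        Σ (Fin n → Fin N) λ f → Injective _≡_ _≡_ f × (∀ k → P (f k))
  ≤countFin⇒injection n≤ = f , f-inj , f-P
    where
      f = λ k → lookup L (inject≤ k n≤)
      f-inj : Injective _≡_ _≡_ f
      f-inj {i} {j} e = Fin.inject≤-injective n≤ n≤ i j
                          (lookup-injective (filter⁺ P? (allFin⁺ N)) _ _ e)
      f-P : ∀ k → P (f k)
      f-P k = proj₂ (∈-filter⁻ P? {xs = allFin N} (∈-lookup {xs = L} _))

  injection⇒≤countFin : ∀ {n} (f : Fin n → Fin N) → Injective _≡_ _≡_ f → (∀ k → P (f k)) →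
                        n ≤ countFin N P P?
  injection⇒≤countFin f f-inj f-P = Fin.injective⇒≤ g-inj
    where
      f∈L : ∀ k → f k ∈ L
      f∈L k = ∈-filter⁺ P? (∈-allFin (f k)) (f-P k)
      g-inj : Injective _≡_ _≡_ (λ k → index (f∈L k))
      g-inj {i} {j} e = f-inj (trans (lookup-index (f∈L i))
                                (trans (cong (lookup L) e) (sym (lookup-index (f∈L j)))))

  1≤countFin⇒∃ : 1 ≤ countFin N P P? → ∃ P
  1≤countFin⇒∃ 1≤ = let (f , _ , f-P) = ≤countFin⇒injection 1≤ in f zero , f-P zero

  2≤countFin⇒∃₂ : 2 ≤ countFin N P P? → ∃₂ λ x y → x ≢ y × P x × P y
  2≤countFin⇒∃₂ 2≤ = let (f , f-inj , f-P) = ≤countFin⇒injection 2≤ in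
    f zero , f (suc zero) , (λ e → 0≢1 (f-inj e)) , f-P zero , f-P (suc zero)
    where 0≢1 : zero ≢ suc {1} zero
          0≢1 ()

  ∃⇒1≤countFin : ∀ {x} → P x → 1 ≤ countFin N P P?
  ∃⇒1≤countFin {x} Px = injection⇒≤countFin {1} (λ _ → x) (λ { {zero} {zero} _ → refl }) (λ _ → Px)

  ∃₂⇒2≤countFin : ∀ {x y} → x ≢ y → P x → P y → 2 ≤ countFin N P P?
  ∃₂⇒2≤countFin {x} {y} x≢y Px Py = injection⇒≤countFin f f-inj f-P
    where
      f : Fin 2 → Fin N
      f zero = x
      f (suc _) = y
      f-inj : Injective _≡_ _≡_ f
      f-inj {zero} {zero} _ = refl
      f-inj {zero} {suc zero} e = ⊥-elim (x≢y e)
      f-inj {suc zero} {zero} e = ⊥-elim (x≢y (sym e))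
      f-inj {suc zero} {suc zero} _ = refl
      f-P : ∀ k → P (f k)
      f-P zero = Px
      f-P (suc _) = Py

  ∃!⇒countFin≡1 : ∀ {x} → P x → (∀ {y} → P y → y ≡ x) → countFin N P P? ≡ 1
  ∃!⇒countFin≡1 {x} Px unique with countFin N P P? in eq
  ... | zero = ⊥-elim (<-irrefl refl (subst (1 ≤_) eq (∃⇒1≤countFin Px)))
  ... | suc zero = refl
  ... | suc (suc _) =
    let (y , z , y≢z , Py , Pz) = 2≤countFin⇒∃₂ (subst (2 ≤_) (sym eq) (s≤s (s≤s z≤n)))
    in ⊥-elim (y≢z (trans (unique Py) (sym (unique Pz))))

injective⇒surjective : ∀ {n} {f : Fin n → Fin n} → Injective _≡_ _≡_ f → ∀ y → ∃[ x ] f x ≡ y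
injective⇒surjective {zero} _ ()
injective⇒surjective {suc n} {f} f-inj y with Fin.any? (λ x → f x ≟ y)
... | yes hit = hit
... | no miss = ⊥-elim (<-irrefl refl (Fin.injective⇒≤ g-inj))
  where
    y≢f : ∀ x → y ≢ f x
    y≢f x e = miss (x , sym e)
    g-inj : Injective _≡_ _≡_ (λ x → punchOut (y≢f x))
    g-inj e = f-inj (Fin.punchOut-injective (y≢f _) (y≢f _) e)

another : ∀ {n} → 1 < n → (x : Fin n) → ∃[ y ] y ≢ x
another (s≤s (s≤s _)) zero = suc zero , λ ()
another (s≤s (s≤s _)) (suc _) = zero , λ ()

pigeonhole-⊎ : ∀ {n} → 0 < n → (f : Fin n ⊎ Fin n → Fin n) → ∃₂ λ σ σ′ → σ ≢ σ′ × f σ ≡ f σ′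
pigeonhole-⊎ {n} n>0 f =
  let (z , z′ , z<z′ , fz≡fz′) = Fin.pigeonhole (m<m+n n n>0) (λ z → f (splitAt n z))
  in splitAt n z , splitAt n z′ , (λ e → Fin.<-irrefl (splitAt-injective e) z<z′) , fz≡fz′
  where
    splitAt-injective : ∀ {z z′} → splitAt n z ≡ splitAt n z′ → z ≡ z′
    splitAt-injective e = trans (sym (Fin.join-splitAt n n _)) (trans (cong (join n n) e) (Fin.join-splitAt n n _))

module Modular (p : ℕ) .{{_ : NonZero p}} where

  infix 4 _≈_ _≉_
  record _≈_ (x y : ℕ) : Set where
    constructor mod-p
    field %-≡ : x % p ≡ y % p
  open _≈_ public

  _≉_ : ℕ → ℕ → Set
  x ≉ y = ¬ x ≈ y

  ≈-isEquivalence : IsEquivalence _≈_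
  ≈-isEquivalence = record
    { refl = mod-p refl
    ; sym = λ e → mod-p (sym (%-≡ e))
    ; trans = λ e f → mod-p (trans (%-≡ e) (%-≡ f))
    }

  ≈-setoid : Setoid 0ℓ 0ℓ
  ≈-setoid = record { isEquivalence = ≈-isEquivalence }

  open IsEquivalence ≈-isEquivalence public
    using (reflexive) renaming (refl to ≈-refl; sym to ≈-sym; trans to ≈-trans)

  module ≈-Reasoning = SetoidReasoning ≈-setoid

  0%p≡0 : 0 % p ≡ 0
  0%p≡0 = m<n⇒m%n≡m (n>0 p)
    where n>0 : ∀ n .{{_ : NonZero n}} → 0 < n
          n>0 (suc _) = s≤s z≤n

  +-cong : ∀ {a a′ b b′} → a ≈ a′ → b ≈ b′ → a + b ≈ a′ + b′
  +-cong {a} {a′} {b} {b′} (mod-p e) (mod-p f) = mod-p (begin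
    (a + b) % p           ≡⟨ %-distribˡ-+ a b p ⟩
    (a % p + b % p) % p   ≡⟨ cong₂ (λ u v → (u + v) % p) e f ⟩
    (a′ % p + b′ % p) % p ≡⟨ %-distribˡ-+ a′ b′ p ⟨
    (a′ + b′) % p         ∎)
    where open ≡-Reasoning

  *-cong : ∀ {a a′ b b′} → a ≈ a′ → b ≈ b′ → a * b ≈ a′ * b′
  *-cong {a} {a′} {b} {b′} (mod-p e) (mod-p f) = mod-p (begin
    (a * b) % p           ≡⟨ %-distribˡ-* a b p ⟩
    (a % p * (b % p)) % p ≡⟨ cong₂ (λ u v → (u * v) % p) e f ⟩
    (a′ % p * (b′ % p)) % p ≡⟨ %-distribˡ-* a′ b′ p ⟨
    (a′ * b′) % p         ∎)
    where open ≡-Reasoning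

  m%p≈m : ∀ m → m % p ≈ m
  m%p≈m m = mod-p (m%n%n≡m%n m p)

  p≈0 : p ≈ 0
  p≈0 = mod-p (trans (n%n≡0 p) (sym 0%p≡0))

  -ₚ_ : ℕ → ℕ
  -ₚ x = p ∸ x % p

  +-inverseʳ : ∀ x → x + -ₚ x ≈ 0
  +-inverseʳ x = ≈-trans (+-cong (≈-sym (m%p≈m x)) ≈-refl)
                         (≈-trans (reflexive (m+[n∸m]≡n (m%n≤n x p))) p≈0)

  [m+n]-n≈m : ∀ m n → (m + n) + -ₚ n ≈ m
  [m+n]-n≈m m n = begin
    (m + n) + -ₚ n ≡⟨ +-assoc m n (-ₚ n) ⟩
    m + (n + -ₚ n) ≈⟨ +-cong ≈-refl (+-inverseʳ n) ⟩
    m + 0          ≡⟨ +-identityʳ m ⟩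
    m              ∎
    where open ≈-Reasoning

  m+[n-m]≈n : ∀ m n → m + (n + -ₚ m) ≈ n
  m+[n-m]≈n m n = ≈-trans (reflexive (sym (x+y+z≡y+[x+z] n m (-ₚ m)))) ([m+n]-n≈m n m)

  +-cancelʳ : ∀ {a b} c → a + c ≈ b + c → a ≈ b
  +-cancelʳ {a} {b} c e = ≈-trans (≈-sym ([m+n]-n≈m a c)) (≈-trans (+-cong e ≈-refl) ([m+n]-n≈m b c))

  ∣⇒≈0 : ∀ {n} → p ∣ n → n ≈ 0
  ∣⇒≈0 {n} p∣n = mod-p (trans (n∣m⇒m%n≡0 n p p∣n) (sym 0%p≡0))

  ≈0⇒∣ : ∀ {n} → n ≈ 0 → p ∣ n
  ≈0⇒∣ {n} (mod-p e) = m%n≡0⇒n∣m n p (trans e 0%p≡0)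

  ≈⇒∣∸ : ∀ {x y} → y ≤ x → x ≈ y → p ∣ x ∸ y
  ≈⇒∣∸ {x} {y} y≤x e = ≈0⇒∣ (+-cancelʳ y (≈-trans (reflexive (m∸n+n≡m y≤x)) e))

  ∣∸⇒≈ : ∀ {x y} → y ≤ x → p ∣ x ∸ y → x ≈ y
  ∣∸⇒≈ {x} {y} y≤x p∣ = ≈-trans (reflexive (sym (m∸n+n≡m y≤x))) (+-cong (∣⇒≈0 p∣) ≈-refl)

  private
    ∣x-y∣≡x∸y : ∀ {x y} → y ≤ x → ℤ.∣ + x - + y ∣ ≡ x ∸ y
    ∣x-y∣≡x∸y {x} {y} y≤x = cong ℤ.∣_∣ (trans (ℤ.m-n≡m⊖n x y) (ℤ.⊖-≥ y≤x))

    ∣x-y∣≡y∸x : ∀ {x y} → x ≤ y → ℤ.∣ + x - + y ∣ ≡ y ∸ x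
    ∣x-y∣≡y∸x {x} {y} x≤y = trans (cong ℤ.∣_∣ (ℤ.m-n≡m⊖n x y))
                              (trans (ℤ.∣m⊖n∣≡∣n⊖m∣ x y) (cong ℤ.∣_∣ (ℤ.⊖-≥ x≤y)))

  ≡[mod]⇒≈ : ∀ {x y} → x ≡[mod p ] y → x ≈ y
  ≡[mod]⇒≈ {x} {y} p∣ with ≤-total y x
  ... | inj₁ y≤x = ∣∸⇒≈ y≤x (subst (p ∣_) (∣x-y∣≡x∸y y≤x) p∣)
  ... | inj₂ x≤y = ≈-sym (∣∸⇒≈ x≤y (subst (p ∣_) (∣x-y∣≡y∸x x≤y) p∣))

  ≈⇒≡[mod] : ∀ {x y} → x ≈ y → x ≡[mod p ] y
  ≈⇒≡[mod] {x} {y} e with ≤-total y x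
  ... | inj₁ y≤x = subst (p ∣_) (sym (∣x-y∣≡x∸y y≤x)) (≈⇒∣∸ y≤x e)
  ... | inj₂ x≤y = subst (p ∣_) (sym (∣x-y∣≡y∸x x≤y)) (≈⇒∣∸ x≤y (≈-sym e))

  toℕ-injective-≈ : ∀ {a b : Fin p} → toℕ a ≈ toℕ b → a ≡ b
  toℕ-injective-≈ {a} {b} (mod-p e) =
    Fin.toℕ-injective (trans (sym (m<n⇒m%n≡m (Fin.toℕ<n a))) (trans e (m<n⇒m%n≡m (Fin.toℕ<n b))))

  toℕ-mod : ∀ n → toℕ (n mod p) ≈ n
  toℕ-mod n = ≈-trans (reflexive (Fin.toℕ-fromℕ< _)) (m%p≈m n)

  module _ (p-prime : Prime p) where

    *-cancelʳ-∸ : ∀ {x y c} → c ≉ 0 → y ≤ x → x * c ≈ y * c → p ∣ x ∸ y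
    *-cancelʳ-∸ {x} {y} {c} c≉0 y≤x e
      with euclidsLemma (x ∸ y) c p-prime
             (subst (p ∣_) (sym (*-distribʳ-∸ c x y)) (≈⇒∣∸ (*-monoˡ-≤ c y≤x) e))
    ... | inj₁ p∣x∸y = p∣x∸y
    ... | inj₂ p∣c = ⊥-elim (c≉0 (∣⇒≈0 p∣c))

    *-cancelʳ-≈ : ∀ {a b c} → c ≉ 0 → a * c ≈ b * c → a ≈ b
    *-cancelʳ-≈ {a} {b} c≉0 e with ≤-total b a
    ... | inj₁ b≤a = ∣∸⇒≈ b≤a (*-cancelʳ-∸ c≉0 b≤a e)
    ... | inj₂ a≤b = ≈-sym (∣∸⇒≈ a≤b (*-cancelʳ-∸ c≉0 a≤b (≈-sym e)))

    ∃-inverse : ∀ {c} → c ≉ 0 → ∃[ m ] m * c ≈ 1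
    ∃-inverse {c} c≉0 =
      let (k , fk≡1) = injective⇒surjective f-inj (1 mod p)
      in toℕ k , ≈-trans (≈-sym (toℕ-mod (toℕ k * c))) (≈-trans (reflexive (cong toℕ fk≡1)) (toℕ-mod 1))
      where
        f : Fin p → Fin p
        f k = (toℕ k * c) mod p
        f-inj : Injective _≡_ _≡_ f
        f-inj {i} {j} e = toℕ-injective-≈ (*-cancelʳ-≈ c≉0
          (≈-trans (≈-sym (toℕ-mod _)) (≈-trans (reflexive (cong toℕ e)) (toℕ-mod _))))

module Configuration {N K : ℕ} (C : CoherentConfiguration N K) {m : ℕ} (F : CC.Fibers C m) where
  open CoherentConfiguration C
  open CC C
  open Fibers F
  open FiberNotions F

  Path : Fin K → Fin K → Fin N → Fin N → Pred (Fin N) 0ℓ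
  Path s t a b c = r a c ≡ s × r c b ≡ t

  Path? : ∀ s t a b → Decidable (Path s t a b)
  Path? s t a b c = (r a c ≟ s) ×-dec (r c b ≟ t)

  paths : Fin K → Fin K → Fin N → Fin N → ℕ
  paths s t a b = countFin N (Path s t a b) (Path? s t a b)

  path-transfer : ∀ {a b a′ b′} s t → r a b ≡ r a′ b′ → ∃ (Path s t a b) → ∃ (Path s t a′ b′)
  path-transfer {a} {b} {a′} {b′} s t e (c , path) =
    1≤countFin⇒∃ (Path? s t a′ b′)
      (subst (1 ≤_) (coh s t a b a′ b′ e) (∃⇒1≤countFin (Path? s t a b) path))

  thin-functional : ∀ {u a b c} → valency u 1 → r a b ≡ u → r a c ≡ u → b ≡ c
  thin-functional {u} {a} {b} {c} val ab ac with b ≟ c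
  ... | yes b≡c = b≡c
  ... | no b≢c = ⊥-elim (<-irrefl refl
          (subst (2 ≤_) (val a (b , ab)) (∃₂⇒2≤countFin (λ x → r a x ≟ u) b≢c ab ac)))

  r-fibˡ : ∀ {a b a′ b′} → r a b ≡ r a′ b′ → fib a ≡ fib a′
  r-fibˡ {a} {b} e with path-transfer (r a a) (r a b) e (a , refl , refl)
  ... | c , a′c , _ with diag a _ c (sym a′c)
  ... | refl = same-fib a _ (sym a′c)

  r-fibʳ : ∀ {a b a′ b′} → r a b ≡ r a′ b′ → fib b ≡ fib b′
  r-fibʳ {a} {b} e with path-transfer (r a b) (r b b) e (b , refl , refl)
  ... | c , _ , cb′ with diag b c _ (sym cb′)
  ... | refl = same-fib b _ (sym cb′)

  r∈S : ∀ a b → InS (fib a) (fib b) (r a b)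
  r∈S a b _ _ e = r-fibˡ e , r-fibʳ e

  thin-translateˡ : ∀ {u β δ β₂ δ₂ β′ β₂′} → valency u 1 → r β δ ≡ r β₂ δ₂ →
                    r β β′ ≡ u → r β₂ β₂′ ≡ u → r β′ δ ≡ r β₂′ δ₂
  thin-translateˡ {u} {β′ = β′} val e ββ′ β₂β₂′ with path-transfer u (r β′ _) e (β′ , ββ′ , refl)
  ... | ζ , β₂ζ , ζδ₂ = sym (subst (λ z → r z _ ≡ r β′ _) (thin-functional val β₂ζ β₂β₂′) ζδ₂)

  thin-translateʳ : ∀ {v β δ β₂ δ₂ δ′ δ₂′} → valency v 1 → r β δ ≡ r β₂ δ₂ →
                    r δ δ′ ≡ v → r δ₂ δ₂′ ≡ v → r β δ′ ≡ r β₂ δ₂′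
  thin-translateʳ {v} {β} {δ} {β₂} {δ₂} {δ′} val e δδ′ δ₂δ₂′
    with path-transfer (r β δ′) (r δ′ δ) e (δ′ , refl , refl)
  ... | ζ , β₂ζ , ζδ₂ =
    sym (subst (λ z → r β₂ z ≡ r β δ′)
               (thin-functional val (trans (conv ζ δ₂ δ′ δ ζδ₂) δδ′) δ₂δ₂′) β₂ζ)

  Pow-translate : ∀ {u v n β δ β₂ δ₂ β′ δ′ β₂′ δ₂′} → valency u 1 → valency v 1 →
                  r β δ ≡ r β₂ δ₂ → Pow u n β β′ → Pow v n δ δ′ → Pow u n β₂ β₂′ → Pow v n δ₂ δ₂′ →
                  r β′ δ′ ≡ r β₂′ δ₂′
  Pow-translate _ _ e (pow0 _) (pow0 _) (pow0 _) (pow0 _) = e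
  Pow-translate valu valv e (powS q₁ e₁) (powS q₂ e₂) (powS q₃ e₃) (powS q₄ e₄) =
    thin-translateʳ valv (thin-translateˡ valu (Pow-translate valu valv e q₁ q₂ q₃ q₄) e₁ e₃) e₂ e₄

  Pow-trans : ∀ {u a b β γ δ} → Pow u a β γ → Pow u b γ δ → Pow u (b + a) β δ
  Pow-trans q (pow0 _) = q
  Pow-trans q (powS q′ e) = powS (Pow-trans q q′) e

  Pow-split : ∀ {u} a b {β δ} → Pow u (b + a) β δ → ∃[ γ ] (Pow u a β γ × Pow u b γ δ)
  Pow-split a zero q = _ , q , pow0 _
  Pow-split a (suc b) (powS q e) = let (γ , q₁ , q₂) = Pow-split a b q in γ , q₁ , powS q₂ e

module Wreath (p : ℕ) (p-prime : Prime p) {N K : ℕ} (C : CoherentConfiguration N K) {m : ℕ}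
              (F : CC.Fibers C m) (iso : ∀ i → CC.FiberNotions.IsoWr C F p i) where
  open CoherentConfiguration C
  open CC C
  open Fibers F
  open FiberNotions F
  open Configuration C F

  instance
    p≢0 : NonZero p
    p≢0 = prime⇒nonZero p-prime

  open Modular p

  φ : Fin m → Fin N → Fin p × Fin p
  φ i = proj₁ (iso i)

  ψ : Fin m → Fin p × Fin p → Fin N
  ψ i = proj₁ (proj₂ (iso i))

  ψ-fib : ∀ i z → fib (ψ i z) ≡ i
  ψ-fib i = proj₁ (proj₂ (proj₂ (iso i)))

  φ∘ψ : ∀ i z → φ i (ψ i z) ≡ z
  φ∘ψ i = proj₁ (proj₂ (proj₂ (proj₂ (iso i))))

  ψ∘φ : ∀ i {β} → fib β ≡ i → ψ i (φ i β) ≡ β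
  ψ∘φ i {β} = proj₁ (proj₂ (proj₂ (proj₂ (proj₂ (iso i))))) β

  colour-iso : ∀ i {β γ β′ γ′} → fib β ≡ i → fib γ ≡ i → fib β′ ≡ i → fib γ′ ≡ i →
               (r β γ ≡ r β′ γ′ → SameWr p (φ i β) (φ i γ) (φ i β′) (φ i γ′)) ×
               (SameWr p (φ i β) (φ i γ) (φ i β′) (φ i γ′) → r β γ ≡ r β′ γ′)
  colour-iso i {β} {γ} {β′} {γ′} = proj₂ (proj₂ (proj₂ (proj₂ (proj₂ (iso i))))) β γ β′ γ′

  block : Fin m → Fin N → Fin p
  block i β = proj₂ (φ i β)

  offset : Fin m → Fin N → ℕ
  offset i β = toℕ (proj₁ (φ i β))

  coords-injective : ∀ {i β γ} → fib β ≡ i → fib γ ≡ i → block i β ≡ block i γ →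
                     offset i β ≈ offset i γ → β ≡ γ
  coords-injective {i} fβ fγ same-block same-offset =
    trans (sym (ψ∘φ i fβ))
      (trans (cong (ψ i) (cong₂ _,_ (toℕ-injective-≈ same-offset) same-block)) (ψ∘φ i fγ))

  same-block-colour : ∀ {i β γ a c} → fib β ≡ i → fib γ ≡ i → fib a ≡ i →
                      block i β ≡ block i γ → r a c ≡ r β γ →
                      block i a ≡ block i c × offset i γ + offset i a ≈ offset i c + offset i β
  same-block-colour {i} fβ fγ fa βγ-block ac with proj₁ (colour-iso i fβ fγ fa (trans (r-fibʳ ac) fγ)) (sym ac)
  ... | inj₁ (_ , ac-block , d) = ac-block , ≡[mod]⇒≈ d
  ... | inj₂ (βγ-block′ , _ , _) = ⊥-elim (βγ-block′ βγ-block)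

  same-block⇒thin : ∀ {i β γ} → fib β ≡ i → fib γ ≡ i → block i β ≡ block i γ → InO i (r β γ)
  same-block⇒thin {i} {β} {γ} fβ fγ βγ-block = (λ _ _ e → trans (r-fibˡ e) fβ , trans (r-fibʳ e) fγ) , val
    where
      val : valency (r β γ) 1
      val a (c₀ , ac₀) = ∃!⇒countFin≡1 (λ x → r a x ≟ r β γ) ac₀ unique
        where
          unique : ∀ {c} → r a c ≡ r β γ → c ≡ c₀
          unique {c} ac =
            let fa = trans (r-fibˡ ac₀) fβ
                (ac-block , ac-offset) = same-block-colour fβ fγ fa βγ-block ac
                (ac₀-block , ac₀-offset) = same-block-colour fβ fγ fa βγ-block ac₀
            in coords-injective (trans (r-fibʳ ac) fγ) (trans (r-fibʳ ac₀) fγ) (trans (sym ac-block) ac₀-block)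
                 (+-cancelʳ (offset i β) (≈-trans (≈-sym ac-offset) ac₀-offset))

  cross-block-colour : ∀ {i β γ β′ γ′} → fib β ≡ i → fib γ ≡ i → fib β′ ≡ i → fib γ′ ≡ i →
                       block i β ≡ block i β′ → block i γ ≡ block i γ′ → block i β ≢ block i γ →
                       r β γ ≡ r β′ γ′
  cross-block-colour {i} fβ fγ fβ′ fγ′ ββ′-block γγ′-block βγ-block′ = proj₂ (colour-iso i fβ fγ fβ′ fγ′)
    (inj₂ (βγ-block′ , (λ e → βγ-block′ (trans ββ′-block (trans e (sym γγ′-block)))) ,
           ≈⇒≡[mod] (reflexive (cong₂ (λ y z → toℕ y + toℕ z) γγ′-block (sym ββ′-block)))))

  p>1 : 1 < p
  p>1 = nonTrivial⇒n>1 p {{prime⇒nonTrivial p-prime}}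

  thin⇒same-block : ∀ {i u β γ} → InO i u → fib β ≡ i → r β γ ≡ u → block i β ≡ block i γ
  thin⇒same-block {i} {u} {β} {γ} (u∈S , val) fβ βγ with block i β ≟ block i γ
  ... | yes βγ-block = βγ-block
  ... | no βγ-block′ =
    ⊥-elim (proj₂ x′ (trans (sym (cong proj₁ (φ∘ψ i _))) (cong (λ z → proj₁ (φ i z)) (sym γ≡γ′))))
    where
      fγ = proj₂ (u∈S β γ βγ)
      x′ = another p>1 (proj₁ (φ i γ))
      γ′ = ψ i (proj₁ x′ , block i γ)
      βγ≡βγ′ : r β γ ≡ r β γ′
      βγ≡βγ′ = cross-block-colour fβ fγ fβ (ψ-fib i _) refl (sym (cong proj₂ (φ∘ψ i _))) βγ-block′
      γ≡γ′ : γ ≡ γ′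
      γ≡γ′ = thin-functional val βγ (trans (sym βγ≡βγ′) βγ)

  private
    ref₀ ref₁ : Fin K → Fin N
    ref₀ u = proj₁ (surj u)
    ref₁ u = proj₁ (proj₂ (surj u))

    ref-colour : ∀ u → r (ref₀ u) (ref₁ u) ≡ u
    ref-colour u = proj₂ (proj₂ (surj u))

  shift : Fin m → Fin K → ℕ
  shift i u = offset i (ref₁ u) + -ₚ offset i (ref₀ u)

  thin-offset : ∀ {i u β γ} → InO i u → r β γ ≡ u → offset i γ ≈ offset i β + shift i u
  thin-offset {i} {u} {β} {γ} u∈O@(u∈S , _) βγ = begin
    offset i γ                   ≈⟨ [m+n]-n≈m (offset i γ) x₀ ⟨
    offset i γ + x₀ + -ₚ x₀      ≈⟨ +-cong (≈-sym ref-βγ) ≈-refl ⟩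
    x₁ + offset i β + -ₚ x₀      ≡⟨ x+y+z≡y+[x+z] x₁ (offset i β) (-ₚ x₀) ⟩
    offset i β + shift i u       ∎
    where
      open ≈-Reasoning
      x₀ = offset i (ref₀ u)
      x₁ = offset i (ref₁ u)
      f₀ = proj₁ (u∈S _ _ (ref-colour u))
      f₁ = proj₂ (u∈S _ _ (ref-colour u))
      ref-βγ : x₁ + offset i β ≈ offset i γ + x₀
      ref-βγ = proj₂ (same-block-colour f₀ f₁ (proj₁ (u∈S β γ βγ))
                        (thin⇒same-block u∈O f₀ (ref-colour u)) (trans βγ (sym (ref-colour u))))

  zero-shift⇒identity : ∀ {i u β γ} → InO i u → shift i u ≈ 0 → r β γ ≡ u → γ ≡ β
  zero-shift⇒identity u∈O@(u∈S , _) shift≈0 βγ =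
    coords-injective (proj₂ (u∈S _ _ βγ)) (proj₁ (u∈S _ _ βγ))
      (sym (thin⇒same-block u∈O (proj₁ (u∈S _ _ βγ)) βγ))
      (≈-trans (thin-offset u∈O βγ) (≈-trans (+-cong ≈-refl shift≈0) (reflexive (+-identityʳ _))))

  orbit⇒same-block : ∀ {i β γ} → fib β ≡ i → InOrbit i β γ → block i β ≡ block i γ
  orbit⇒same-block fβ (_ , u∈O , βγ) = thin⇒same-block u∈O fβ βγ

  orbit⇒fib : ∀ {i β γ} → InOrbit i β γ → fib γ ≡ i
  orbit⇒fib (_ , (u∈S , _) , βγ) = proj₂ (u∈S _ _ βγ)

  same-block⇒orbit : ∀ {i β γ} → fib β ≡ i → fib γ ≡ i → block i β ≡ block i γ → InOrbit i β γ
  same-block⇒orbit fβ fγ βγ-block = _ , same-block⇒thin fβ fγ βγ-block , refl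

  thin-successor : ∀ {i u β} → InO i u → fib β ≡ i → ∃[ γ ] r β γ ≡ u
  thin-successor {i} {u} {β} (u∈S , _) fβ =
    let (γ , βγ , _) = path-transfer u (r (ref₁ u) (ref₀ u))
                         (fib-same (ref₀ u) β (trans (proj₁ (u∈S _ _ (ref-colour u))) (sym fβ)))
                         (ref₁ u , ref-colour u , refl)
    in γ , βγ

  module _ {i u} (u∈O : InO i u) where

    Pow-fib : ∀ {a β γ} → fib β ≡ i → Pow u a β γ → fib γ ≡ i
    Pow-fib fβ (pow0 _) = fβ
    Pow-fib _ (powS _ e) = proj₂ (proj₁ u∈O _ _ e)

    Pow-exists : ∀ {β} → fib β ≡ i → ∀ a → ∃[ γ ] Pow u a β γ
    Pow-exists {β} fβ zero = β , pow0 β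
    Pow-exists fβ (suc a) =
      let (γ , q) = Pow-exists fβ a
          (δ , γδ) = thin-successor u∈O (Pow-fib fβ q)
      in δ , powS q γδ

    walk : ∀ {β} → fib β ≡ i → ℕ → Fin N
    walk fβ n = proj₁ (Pow-exists fβ n)

    walk-Pow : ∀ {β} (fβ : fib β ≡ i) n → Pow u n β (walk fβ n)
    walk-Pow fβ n = proj₂ (Pow-exists fβ n)

    walk-fib : ∀ {β} (fβ : fib β ≡ i) n → fib (walk fβ n) ≡ i
    walk-fib fβ n = Pow-fib fβ (walk-Pow fβ n)

    Pow-block : ∀ {a β γ} → fib β ≡ i → Pow u a β γ → block i β ≡ block i γ
    Pow-block fβ (pow0 _) = refl
    Pow-block fβ (powS q e) = trans (Pow-block fβ q) (thin⇒same-block u∈O (Pow-fib fβ q) e)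

    Pow-offset : ∀ {a β γ} → Pow u a β γ → offset i γ ≈ offset i β + a * shift i u
    Pow-offset {β = β} (pow0 _) = reflexive (sym (+-identityʳ (offset i β)))
    Pow-offset {β = β} (powS {a} {γ = γ} {δ} q e) = begin
      offset i δ                                ≈⟨ thin-offset u∈O e ⟩
      offset i γ + shift i u                    ≈⟨ +-cong (Pow-offset q) ≈-refl ⟩
      offset i β + a * shift i u + shift i u    ≡⟨ +-assoc (offset i β) _ _ ⟩
      offset i β + (a * shift i u + shift i u)  ≡⟨ cong (λ x → offset i β + x) (+-comm (a * shift i u) _) ⟩
      offset i β + suc a * shift i u            ∎
      where open ≈-Reasoning

    Pow-unique : ∀ {a b β γ γ′} → fib β ≡ i → Pow u a β γ → Pow u b β γ′ → a ≈ b → γ ≡ γ′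
    Pow-unique fβ q q′ a≈b =
      coords-injective (Pow-fib fβ q) (Pow-fib fβ q′) (trans (sym (Pow-block fβ q)) (Pow-block fβ q′))
        (≈-trans (Pow-offset q) (≈-trans (+-cong ≈-refl (*-cong a≈b ≈-refl)) (≈-sym (Pow-offset q′))))

    Pow-onto-block : shift i u ≉ 0 → ∀ {β γ} → fib β ≡ i → fib γ ≡ i → block i β ≡ block i γ →
                     ∃[ a ] Pow u (toℕ {p} a) β γ
    Pow-onto-block shift≉0 {β} {γ} fβ fγ βγ-block =
      a , subst (Pow u (toℕ a) β)
                (coords-injective (Pow-fib fβ q) fγ (trans (sym (Pow-block fβ q)) βγ-block) γ′≈γ) q
      where
        c = shift i u
        inverse = ∃-inverse p-prime shift≉0
        d = offset i γ + -ₚ offset i β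
        a = (d * proj₁ inverse) mod p
        q = proj₂ (Pow-exists fβ (toℕ a))
        γ′≈γ : offset i (proj₁ (Pow-exists fβ (toℕ a))) ≈ offset i γ
        γ′≈γ = begin
          _                                    ≈⟨ Pow-offset q ⟩
          offset i β + toℕ a * c               ≈⟨ +-cong (≈-refl {offset i β}) (*-cong (toℕ-mod _) ≈-refl) ⟩
          offset i β + d * proj₁ inverse * c   ≡⟨ cong (λ x → offset i β + x) (*-assoc d _ c) ⟩
          offset i β + d * (proj₁ inverse * c) ≈⟨ +-cong (≈-refl {offset i β})
                                                          (*-cong (≈-refl {d}) (proj₂ inverse)) ⟩
          offset i β + d * 1                   ≡⟨ cong (λ x → offset i β + x) (*-identityʳ d) ⟩
          offset i β + d                       ≈⟨ m+[n-m]≈n (offset i β) (offset i γ) ⟩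
          offset i γ                           ∎
          where open ≈-Reasoning

  thin-comm : ∀ {i u v a′ a a₁ a″} → InO i u → InO i v → fib a′ ≡ i →
              r a′ a ≡ u → r a a₁ ≡ v → r a′ a″ ≡ v → r a″ a₁ ≡ u
  thin-comm {i} {u} {v} {a′} {a} {a₁} {a″} u∈O v∈O fa′ a′a aa₁ a′a″ =
    subst (λ x → r a″ x ≡ u) (coords-injective fz fa₁ z-block z-offset) a″z
    where
      fa″ = proj₂ (proj₁ v∈O _ _ a′a″)
      fa₁ = proj₂ (proj₁ v∈O _ _ aa₁)
      z = proj₁ (thin-successor u∈O fa″)
      a″z = proj₂ (thin-successor u∈O fa″)
      fz = proj₂ (proj₁ u∈O _ _ a″z)
      z-block : block i z ≡ block i a₁
      z-block = trans (sym (thin⇒same-block u∈O fa″ a″z))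
                  (trans (sym (thin⇒same-block v∈O fa′ a′a″))
                    (trans (thin⇒same-block u∈O fa′ a′a)
                           (thin⇒same-block v∈O (proj₂ (proj₁ u∈O _ _ a′a)) aa₁)))
      z-offset : offset i z ≈ offset i a₁
      z-offset = begin
        offset i z                            ≈⟨ thin-offset u∈O a″z ⟩
        offset i a″ + shift i u               ≈⟨ +-cong (thin-offset v∈O a′a″) ≈-refl ⟩
        offset i a′ + shift i v + shift i u   ≡⟨ x+y+z≡x+z+y (offset i a′) (shift i v) (shift i u) ⟩
        offset i a′ + shift i u + shift i v   ≈⟨ +-cong (thin-offset u∈O a′a) ≈-refl ⟨
        offset i a + shift i v                ≈⟨ thin-offset v∈O aa₁ ⟨
        offset i a₁                           ∎
        where open ≈-Reasoning

module CrossFibres (p : ℕ) (p-prime : Prime p) {N K : ℕ} (C : CoherentConfiguration N K) {m : ℕ}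
  (F : CC.Fibers C m) (iso : ∀ i → CC.FiberNotions.IsoWr C F p i)
  (cross-valency : ∀ i j → i ≢ j → ∀ s → CC.FiberNotions.InS C F i j s → CC.valency C s p)
  (regular-homogeneous : ∀ s → CC.Regular C s → ∃[ i ] CC.FiberNotions.InS C F i i s) where
  open CoherentConfiguration C
  open CC C
  open Fibers F
  open FiberNotions F
  open Configuration C F
  open Wreath p p-prime C F iso
  open Modular p

  BlockClosed : Fin m → Fin K → Set
  BlockClosed j s = ∀ {δ ε ε′} → r δ ε ≡ s → fib ε′ ≡ j → block j ε ≡ block j ε′ → r δ ε′ ≡ s

  two-in-block⇒block-closed : ∀ {j β γ γ′} → fib γ ≡ j → r β γ′ ≡ r β γ → γ ≢ γ′ →
                              block j γ ≡ block j γ′ → BlockClosed j (r β γ)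
  two-in-block⇒block-closed {j} {β} {γ} {γ′} fγ βγ′ γ≢γ′ γγ′-block δε fε′ εε′-block =
    Pow-translates δε (proj₂ (Pow-onto-block v∈O shift≉0 (trans (r-fibʳ δε) fγ) fε′ εε′-block))
    where
      fγ′ = trans (r-fibʳ βγ′) fγ
      -- v is a nontrivial thin element with s v ⊆ s, and its powers sweep whole blocks.
      v = r γ γ′
      v∈O : InO j v
      v∈O = same-block⇒thin fγ fγ′ γγ′-block
      shift≉0 : shift j v ≉ 0
      shift≉0 shift≈0 = γ≢γ′ (sym (zero-shift⇒identity v∈O shift≈0 refl))
      translates : ∀ {δ ε ε′} → r δ ε ≡ r β γ → r ε ε′ ≡ v → r δ ε′ ≡ r β γ
      translates {δ} {ε} {ε′} δε εε′ with path-transfer (r β γ) (r γ′ γ) (sym δε) (γ′ , βγ′ , refl)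
      ... | ζ , δζ , ζε =
        subst (λ z → r δ z ≡ r β γ) (thin-functional (proj₂ v∈O) (conv ζ ε γ′ γ ζε) εε′) δζ
      Pow-translates : ∀ {δ ε ε′ n} → r δ ε ≡ r β γ → Pow v n ε ε′ → r δ ε′ ≡ r β γ
      Pow-translates δε (pow0 _) = δε
      Pow-translates δε (powS q e) = translates (Pow-translates δε q) e

  valency-cross : ∀ {β γ} → fib β ≢ fib γ → valency (r β γ) p
  valency-cross {β} {γ} β≢γ = cross-valency (fib β) (fib γ) β≢γ (r β γ) (r∈S β γ)

  -- Otherwise c would have p + 1 successors of colour s: the block of x, and y.
  block-closed⇒successors-in-block : ∀ {j s c x y} → fib c ≢ j → BlockClosed j s →
                                     r c x ≡ s → r c y ≡ s → fib x ≡ j → block j x ≡ block j y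
  block-closed⇒successors-in-block {j} {c = c} {x} {y} fc≢j closed cx cy fx with block j x ≟ block j y
  ... | yes xy-block = xy-block
  ... | no xy-block′ = ⊥-elim (<-irrefl refl (subst (suc p ≤_) (valency-cross c≢y c (y , refl))
          (injection⇒≤countFin (λ z → r c z ≟ r c y) f f-inj f-colour)))
    where
      fy = trans (r-fibʳ (trans cy (sym cx))) fx
      c≢y : fib c ≢ fib y
      c≢y e = fc≢j (trans e fy)
      in-block : Fin p → Fin N
      in-block k = ψ j (k , block j x)
      in-block-block : ∀ k → block j (in-block k) ≡ block j x
      in-block-block k = cong proj₂ (φ∘ψ j _)
      f : Fin (suc p) → Fin N
      f zero = y
      f (suc k) = in-block k
      f-inj : Injective _≡_ _≡_ f
      f-inj {zero} {zero} _ = refl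
      f-inj {zero} {suc k} e = ⊥-elim (xy-block′ (sym (trans (cong (block j) e) (in-block-block k))))
      f-inj {suc k} {zero} e = ⊥-elim (xy-block′ (sym (trans (cong (block j) (sym e)) (in-block-block k))))
      f-inj {suc k} {suc k′} e = cong suc (cong proj₁ (trans (sym (φ∘ψ j _)) (trans (cong (φ j) e) (φ∘ψ j _))))
      f-colour : ∀ k → r c (f k) ≡ r c y
      f-colour zero = refl
      f-colour (suc k) = trans (closed cx (ψ-fib j _) (sym (in-block-block k))) (sym cy)

  block-closed⇒regular : ∀ {β γ} → fib β ≢ fib γ → BlockClosed (fib γ) (r β γ) → Regular (r β γ)
  block-closed⇒regular {β} {γ} β≢γ closed u = ⊆s , s⊆
    where
      s = r β γ
      ⊆s : InSS*S s u → u ≡ s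
      ⊆s (s* , s*-conv , v , (a , b , ab , c , ac , cb) , (a′ , b′ , a′b′ , c′ , a′c′ , c′b′))
        with path-transfer s (r c b) (trans ab (sym a′c′)) (c , ac , refl)
      ... | c″ , a′c″ , c″c′ = trans (sym a′b′) (closed a′c″ (r-fibʳ c′b′) c″b′-block)
        where
          bc : r b c ≡ s
          bc = conv c b γ β (trans cb (sym (s*-conv β γ refl)))
          c′c″ : r c′ c″ ≡ s
          c′c″ = trans (conv c″ c′ c b c″c′) bc
          c″b′-block : block (fib γ) c″ ≡ block (fib γ) b′
          c″b′-block = block-closed⇒successors-in-block (λ e → β≢γ (trans (sym (r-fibˡ c′b′)) e)) closed
                         c′c″ c′b′ (r-fibʳ c′c″)
      s⊆ : u ≡ s → InSS*S s u
      s⊆ refl = r γ β , (λ a b ab → conv a b β γ ab) , r β β ,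
                (β , β , refl , γ , refl , refl) , (β , γ , refl , β , refl , refl)

  successor-block-unique : ∀ {j β γ γ′} → fib β ≢ j → fib γ ≡ j → r β γ′ ≡ r β γ →
                           block j γ ≡ block j γ′ → γ ≡ γ′
  successor-block-unique {β = β} {γ} {γ′} β≢j refl βγ′ γγ′-block with γ ≟ γ′
  ... | yes γ≡γ′ = γ≡γ′
  ... | no γ≢γ′ = ⊥-elim (β≢j (trans (proj₁ homogeneous) (sym (proj₂ homogeneous))))
    where
      regular = block-closed⇒regular β≢j (two-in-block⇒block-closed refl βγ′ γ≢γ′ γγ′-block)
      homogeneous = proj₂ (regular-homogeneous (r β γ) regular) β γ refl

  two-blocks-of-successors : ∀ {j β γ} → fib β ≢ j → fib γ ≡ j →
                             ∃₂ λ γ₀ γ₀′ → block j γ₀ ≢ block j γ₀′ × r β γ₀ ≡ r β γ × r β γ₀′ ≡ r β γ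
  two-blocks-of-successors {β = β} {γ} β≢j refl =
    let (γ₀ , γ₀′ , γ₀≢γ₀′ , βγ₀ , βγ₀′) = 2≤countFin⇒∃₂ (λ x → r β x ≟ r β γ)
                                             (subst (2 ≤_) (sym (valency-cross β≢j β (γ , refl))) p>1)
    in γ₀ , γ₀′ , (λ e → γ₀≢γ₀′ (successor-block-unique β≢j (r-fibʳ βγ₀) (trans βγ₀′ (sym βγ₀)) e)) ,
       βγ₀ , βγ₀′

  predecessor-block-unique : ∀ {i β β′ γ} → fib β ≡ i → fib γ ≢ i → r β′ γ ≡ r β γ →
                             block i β ≡ block i β′ → β ≡ β′
  predecessor-block-unique {β = β} {β′} {γ} fβ γ≢i β′γ ββ′-block =
    successor-block-unique γ≢i fβ (conv β′ γ β γ β′γ) ββ′-block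

  block-transversal : ∀ {i β δ} → fib β ≡ i → fib δ ≢ i → ∀ y →
                      ∃[ γ ] (fib γ ≡ i × block i γ ≡ y × r γ δ ≡ r β δ)
  block-transversal {β = β} {δ} refl δ≢β y =
    let (k , fk-block) = injective⇒surjective g-inj y
    in f k , fβ k , fk-block , conv δ (f k) δ β (f-colour k)
    where
      injection = ≤countFin⇒injection (λ z → r δ z ≟ r δ β)
                    (≤-reflexive (sym (valency-cross δ≢β δ (β , refl))))
      f = proj₁ injection
      f-colour = proj₂ (proj₂ injection)
      fβ : ∀ k → fib (f k) ≡ fib β
      fβ k = r-fibʳ (f-colour k)
      g-inj : Injective _≡_ _≡_ (λ k → block (fib β) (f k))
      g-inj {k} {k′} e = proj₁ (proj₂ injection)
        (successor-block-unique δ≢β (fβ k) (trans (f-colour k′) (sym (f-colour k))) e)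

module Translations (p : ℕ) (p-prime : Prime p) {N K : ℕ} (C : CoherentConfiguration N K) {m : ℕ}
  (F : CC.Fibers C m) (iso : ∀ i → CC.FiberNotions.IsoWr C F p i)
  (cross-valency : ∀ i j → i ≢ j → ∀ s → CC.FiberNotions.InS C F i j s → CC.valency C s p)
  (regular-homogeneous : ∀ s → CC.Regular C s → ∃[ i ] CC.FiberNotions.InS C F i i s)
  (t : Fin m → Fin K) (t-thin : ∀ i → CC.FiberNotions.InO C F i (t i)) where
  open CoherentConfiguration C
  open CC C
  open Fibers F
  open FiberNotions F
  open Configuration C F
  open Wreath p p-prime C F iso
  open CrossFibres p p-prime C F iso cross-valency regular-homogeneous
  open Modular p

  t-walk : ∀ {i β} → fib β ≡ i → ℕ → Fin N
  t-walk {i} = walk (t-thin i)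

  t-walk-Pow : ∀ {i β} (fβ : fib β ≡ i) n → Pow (t i) n β (t-walk fβ n)
  t-walk-Pow {i} = walk-Pow (t-thin i)

  t-walk-fib : ∀ {i β} (fβ : fib β ≡ i) n → fib (t-walk fβ n) ≡ i
  t-walk-fib {i} = walk-fib (t-thin i)

  Preserves : Fin m → Fin m → ℕ → Fin K → Set
  Preserves i j n w = ∀ {β δ β′ δ′} → fib β ≡ i → fib δ ≡ j → r β δ ≡ w →
                      Pow (t i) n β β′ → Pow (t j) n δ δ′ → r β′ δ′ ≡ w

  PreservedAtSomePair : Fin m → Fin m → ℕ → Fin K → Set
  PreservedAtSomePair i j n w = ∃[ β ] ∃[ δ ] ∃[ β′ ] ∃[ δ′ ]
    (r β δ ≡ w × Pow (t i) n β β′ × Pow (t j) n δ δ′ × r β′ δ′ ≡ w)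

  Invariant : Fin m → Fin m → Set
  Invariant i j = ∀ w → Preserves i j 1 w

  module _ {i j : Fin m} where

    preserved-at-some-pair⇒preserves : ∀ {n w} → PreservedAtSomePair i j n w → Preserves i j n w
    preserved-at-some-pair⇒preserves (_ , _ , _ , _ , β₀δ₀ , q₀ , q₀′ , β₀′δ₀′) _ _ βδ q q′ =
      trans (Pow-translate (proj₂ (t-thin i)) (proj₂ (t-thin j)) (trans βδ (sym β₀δ₀)) q q′ q₀ q₀′) β₀′δ₀′

    preserves-iterate : ∀ {e w} → Preserves i j e w → ∀ n → Preserves i j (n * e) w
    preserves-iterate preserves zero _ _ βδ (pow0 _) (pow0 _) = βδ
    preserves-iterate {e} preserves (suc n) fβ fδ βδ q q′ =
      let (_ , q₁ , q₂) = Pow-split (n * e) e q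
          (_ , q₁′ , q₂′) = Pow-split (n * e) e q′
      in preserves (Pow-fib (t-thin i) fβ q₁) (Pow-fib (t-thin j) fδ q₁′)
           (preserves-iterate preserves n fβ fδ βδ q₁ q₁′) q₂ q₂′

    preserves-≈ : ∀ {a b w} → a ≈ b → Preserves i j a w → Preserves i j b w
    preserves-≈ {a} a≈b preserves fβ fδ βδ q q′ =
      let (_ , q″) = Pow-exists (t-thin i) fβ a
          (_ , r″) = Pow-exists (t-thin j) fδ a
      in subst₂ (λ x y → r x y ≡ _) (Pow-unique (t-thin i) fβ q″ q a≈b) (Pow-unique (t-thin j) fδ r″ q′ a≈b)
           (preserves fβ fδ βδ q″ r″)

    preserves-generator : ∀ {e w} → e ≉ 0 → Preserves i j e w → Preserves i j 1 w
    preserves-generator e≉0 preserves =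
      let (m′ , m′e≈1) = ∃-inverse p-prime e≉0
      in preserves-≈ m′e≈1 (preserves-iterate preserves m′)

    invariant-Pow : Invariant i j → ∀ {n w} → Preserves i j n w
    invariant-Pow invariant {n} {w} =
      subst (λ k → Preserves i j k w) (*-identityʳ n) (preserves-iterate (invariant w) n)

  OrbitCoordinates : Fin m → Fin m → Fin N → Fin N → Fin p → Fin N → Fin N → Set
  OrbitCoordinates i j β₀ γ₀ h β γ =
    Σ (Fin p) λ a → Σ (Fin p) λ b →
      (Pow (t i) (toℕ a) β₀ β × Pow (t j) (toℕ b) γ₀ γ × toℕ b ≡[mod p ] (toℕ a + toℕ h))

  module OrbitPairs {i j} (i≢j : i ≢ j) (invariant-ij : Invariant i j) (t-shift≉0 : shift i (t i) ≉ 0)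
           {β₀ γ₀ γₕ s} (h : Fin p) (fβ₀ : fib β₀ ≡ i) (fγ₀ : fib γ₀ ≡ j)
           (γₕ-Pow : Pow (t j) (toℕ h) γ₀ γₕ) (β₀γₕ : r β₀ γₕ ≡ s) where

    private
      fγₕ = Pow-fib (t-thin j) fγ₀ γₕ-Pow

      partner : ℕ → Fin N
      partner = t-walk fγₕ

      partner-Pow : ∀ a → Pow (t j) (a + toℕ h) γ₀ (partner a)
      partner-Pow a = Pow-trans γₕ-Pow (t-walk-Pow fγₕ a)

      partner-colour : ∀ {a β} → Pow (t i) a β₀ β → r β (partner a) ≡ s
      partner-colour q = invariant-Pow invariant-ij fβ₀ fγₕ β₀γₕ q (t-walk-Pow fγₕ _)

    orbit-pair⇒coordinates : ∀ {β γ} → r β γ ≡ s × InOrbit i β₀ β × InOrbit j γ₀ γ →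
                             OrbitCoordinates i j β₀ γ₀ h β γ
    orbit-pair⇒coordinates {β} {γ} (βγ , β∈orbit , γ∈orbit) =
      a , b , q , subst (Pow (t j) (toℕ b) γ₀) γ′≡γ (proj₂ γ′) , ≈⇒≡[mod] (toℕ-mod (toℕ a + toℕ h))
      where
        fβ = orbit⇒fib β∈orbit
        fγ = orbit⇒fib γ∈orbit
        a-Pow = Pow-onto-block (t-thin i) t-shift≉0 fβ₀ fβ (orbit⇒same-block fβ₀ β∈orbit)
        a = proj₁ a-Pow
        q = proj₂ a-Pow
        b = (toℕ a + toℕ h) mod p
        γ′ = Pow-exists (t-thin j) fγ₀ (toℕ b)
        γ′≡partner : proj₁ γ′ ≡ partner (toℕ a)
        γ′≡partner = Pow-unique (t-thin j) fγ₀ (proj₂ γ′) (partner-Pow (toℕ a)) (toℕ-mod _)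
        γ≡partner : γ ≡ partner (toℕ a)
        γ≡partner = successor-block-unique (λ e → i≢j (trans (sym fβ) e)) fγ (trans (partner-colour q) (sym βγ))
          (trans (sym (orbit⇒same-block fγ₀ γ∈orbit)) (Pow-block (t-thin j) fγ₀ (partner-Pow (toℕ a))))
        γ′≡γ : proj₁ γ′ ≡ γ
        γ′≡γ = trans γ′≡partner (sym γ≡partner)

    coordinates⇒orbit-pair : ∀ {β γ} → OrbitCoordinates i j β₀ γ₀ h β γ →
                             r β γ ≡ s × InOrbit i β₀ β × InOrbit j γ₀ γ
    coordinates⇒orbit-pair {β} {γ} (a , b , q , q′ , b≡a+h) =
      subst (λ x → r β x ≡ s) partner≡γ (partner-colour q) ,
      same-block⇒orbit fβ₀ (Pow-fib (t-thin i) fβ₀ q) (Pow-block (t-thin i) fβ₀ q) ,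
      same-block⇒orbit fγ₀ (Pow-fib (t-thin j) fγ₀ q′) (Pow-block (t-thin j) fγ₀ q′)
      where
        partner≡γ : partner (toℕ a) ≡ γ
        partner≡γ = Pow-unique (t-thin j) fγ₀ (partner-Pow (toℕ a)) q′ (≈-sym (≡[mod]⇒≈ b≡a+h))

  module _ (i₁ : Fin m) (α : Fin m → Fin N) (α-fib : ∀ i → fib (α i) ≡ i)
    (t-base : ∀ i → i ≢ i₁ → ∀ γ δ → r (α i₁) γ ≡ t i₁ → r (α i) δ ≡ t i → r γ δ ≡ r (α i₁) (α i)) where

    base-preserved : ∀ i → i ≢ i₁ → Preserves i₁ i 1 (r (α i₁) (α i))
    base-preserved i i≢i₁ =
      let (γ , α₁γ) = thin-successor (t-thin i₁) (α-fib i₁)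
          (δ , αᵢδ) = thin-successor (t-thin i) (α-fib i)
      in preserved-at-some-pair⇒preserves
           (α i₁ , α i , γ , δ , refl , powS (pow0 _) α₁γ , powS (pow0 _) αᵢδ , t-base i i≢i₁ γ δ α₁γ αᵢδ)

    -- Slide a along its block to a point a′ with r(a′, β) = r(α i₁, α i); t i₁ commutes with the slide.
    invariant-base : ∀ i → i ≢ i₁ → Invariant i₁ i
    invariant-base i i≢i₁ w {a} {β} fa fβ aβ (powS (pow0 _) aa₁) (powS (pow0 _) ββ₁) =
      let (ζ , βζ , ζβ) = path-transfer (r (α i) (α i₁)) (r (α i₁) (α i))
                            (fib-same (α i) β (trans (α-fib i) (sym fβ))) (α i₁ , refl , refl)
          (a′ , fa′ , a′a-block , a′β) = block-transversal (trans (r-fibʳ βζ) (α-fib i₁))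
                                           (λ e → i≢i₁ (trans (sym fβ) e)) (block i₁ a)
          slide = same-block⇒thin fa′ fa a′a-block
          (a″ , a′a″) = thin-successor (t-thin i₁) fa′
          a″β₁ = base-preserved i i≢i₁ fa′ fβ (trans a′β ζβ) (powS (pow0 _) a′a″) (powS (pow0 _) ββ₁)
      in trans (sym (thin-translateˡ (proj₂ slide) (trans (trans a′β ζβ) (sym a″β₁)) refl
                       (thin-comm slide (t-thin i₁) fa′ refl aa₁ a′a″))) aβ

    invariant-base-sym : ∀ i → i ≢ i₁ → Invariant i i₁
    invariant-base-sym i i≢i₁ w {β} {δ} {β′} {δ′} fβ fδ βδ q q′ =
      trans (conv δ′ β′ δ β (invariant-base i i≢i₁ (r δ β) fδ fβ refl q′ q)) βδ

    two-paths : ∀ {i j β δ} → i ≢ i₁ → fib β ≡ i → fib δ ≡ j → j ≢ i →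
                ∃[ a ] (fib a ≡ i₁ × 2 ≤ paths (r (α i₁) (α i)) (r β δ) a δ)
    two-paths {i} {j} {β} {δ} i≢i₁ fβ fδ j≢i =
      let (γ₀ , γ₀′ , γ₀γ₀′-block′ , α₁γ₀ , α₁γ₀′) =
            two-blocks-of-successors (λ e → i≢i₁ (trans (sym e) (α-fib i₁))) (α-fib i)
          fγ₀ = trans (r-fibʳ α₁γ₀) (α-fib i)
          fγ₀′ = trans (r-fibʳ α₁γ₀′) (α-fib i)
          δ≢i = λ e → j≢i (trans (sym fδ) e)
          (γ , fγ , γ-block , γδ) = block-transversal fβ δ≢i (block i γ₀)
          (γ′ , fγ′ , γ′-block , γ′δ) = block-transversal fβ δ≢i (block i γ₀′)
          γγ′-block′ = λ e → γ₀γ₀′-block′ (trans (sym γ-block) (trans e γ′-block))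
          γγ′ = cross-block-colour fγ fγ′ fγ₀ fγ₀′ γ-block γ′-block γγ′-block′
          (a , γa , aγ′) = path-transfer (r γ₀ (α i₁)) (r (α i₁) γ₀′) (sym γγ′) (α i₁ , refl , refl)
          aγ = trans (conv γ a γ₀ (α i₁) γa) α₁γ₀
      in a , trans (r-fibˡ aγ) (α-fib i₁) ,
         ∃₂⇒2≤countFin (Path? _ _ a δ) (λ e → γγ′-block′ (cong (block i) e)) (aγ , γδ) (trans aγ′ α₁γ₀′ , γ′δ)

    block-collision : ∀ {i j a δ w} → i ≢ i₁ → j ≢ i₁ → (fa : fib a ≡ i₁) → (fδ : fib δ ≡ j) →
                      2 ≤ paths (r (α i₁) (α i)) w a δ →
                      ∃[ k₁ ] ∃[ k₂ ] (k₁ ≢ k₂ × ∃[ q₁ ] ∃[ q₂ ] (block i q₁ ≡ block i q₂ ×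
                        Path (r (α i₁) (α i)) w (t-walk fa (toℕ k₁)) (t-walk fδ (toℕ k₁)) q₁ ×
                        Path (r (α i₁) (α i)) w (t-walk fa (toℕ k₂)) (t-walk fδ (toℕ k₂)) q₂))
    block-collision {i} {j} {a} {δ} {w} i≢i₁ j≢i₁ fa fδ 2≤paths =
      let (σ₁ , σ₂ , σ₁≢σ₂ , mid-block) = pigeonhole-⊎ (<-trans (s≤s z≤n) p>1) (λ σ → block i (mid σ))
      in slot σ₁ , slot σ₂ , (λ e → twin-blocks σ₁ σ₂ σ₁≢σ₂ e mid-block) ,
         mid σ₁ , mid σ₂ , mid-block , mid-path σ₁ , mid-path σ₂
      where
        s₀ = r (α i₁) (α i)
        aₖ dₖ : Fin p → Fin N
        aₖ k = t-walk fa (toℕ k)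
        dₖ k = t-walk fδ (toℕ k)
        two : ∀ k → ∃₂ λ x y → x ≢ y × Path s₀ w (aₖ k) (dₖ k) x × Path s₀ w (aₖ k) (dₖ k) y
        two k = 2≤countFin⇒∃₂ (Path? s₀ w (aₖ k) (dₖ k))
                  (subst (2 ≤_) (coh s₀ w a δ (aₖ k) (dₖ k) (sym aₖdₖ)) 2≤paths)
          where aₖdₖ = invariant-Pow (invariant-base j j≢i₁) fa fδ refl
                         (t-walk-Pow fa (toℕ k)) (t-walk-Pow fδ (toℕ k))
        slot : Fin p ⊎ Fin p → Fin p
        slot (inj₁ k) = k
        slot (inj₂ k) = k
        mid : Fin p ⊎ Fin p → Fin N
        mid (inj₁ k) = proj₁ (two k)
        mid (inj₂ k) = proj₁ (proj₂ (two k))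
        mid-path : ∀ σ → Path s₀ w (aₖ (slot σ)) (dₖ (slot σ)) (mid σ)
        mid-path (inj₁ k) = proj₁ (proj₂ (proj₂ (proj₂ (two k))))
        mid-path (inj₂ k) = proj₂ (proj₂ (proj₂ (proj₂ (two k))))
        mid-fib : ∀ σ → fib (mid σ) ≡ i
        mid-fib σ = trans (r-fibʳ (proj₁ (mid-path σ))) (α-fib i)
        twin-blocks : ∀ σ σ′ → σ ≢ σ′ → slot σ ≡ slot σ′ → block i (mid σ) ≢ block i (mid σ′)
        twin-blocks σ σ′ σ≢σ′ same-slot e = twin σ σ′ σ≢σ′ same-slot (successor-block-unique
          (λ e′ → i≢i₁ (trans (sym e′) (t-walk-fib fa (toℕ (slot σ))))) (mid-fib σ)
          (trans (subst (λ k → r (aₖ k) (mid σ′) ≡ s₀) (sym same-slot) (proj₁ (mid-path σ′)))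
                 (sym (proj₁ (mid-path σ)))) e)
          where
            twin : ∀ σ σ′ → σ ≢ σ′ → slot σ ≡ slot σ′ → mid σ ≢ mid σ′
            twin (inj₁ k) (inj₁ _) σ≢σ′ refl _ = σ≢σ′ refl
            twin (inj₂ k) (inj₂ _) σ≢σ′ refl _ = σ≢σ′ refl
            twin (inj₁ k) (inj₂ _) _ refl e = proj₁ (proj₂ (proj₂ (two k))) e
            twin (inj₂ k) (inj₁ _) _ refl e = proj₁ (proj₂ (proj₂ (two k))) (sym e)

    -- Walking q₁ by e = k₂ - k₁ lands on q₂: both are successors of a t_1^k₂ in one block.
    collision⇒preserved : ∀ {i j a δ w} → i ≢ i₁ → (fa : fib a ≡ i₁) → (fδ : fib δ ≡ j) →
      ∀ {k₁ k₂ : Fin p} → k₁ ≢ k₂ → ∀ {q₁ q₂} → block i q₁ ≡ block i q₂ →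
      Path (r (α i₁) (α i)) w (t-walk fa (toℕ k₁)) (t-walk fδ (toℕ k₁)) q₁ →
      Path (r (α i₁) (α i)) w (t-walk fa (toℕ k₂)) (t-walk fδ (toℕ k₂)) q₂ →
      ∃[ e ] (e ≉ 0 × PreservedAtSomePair i j e w)
    collision⇒preserved {i} {j} {a} {δ} {w} i≢i₁ fa fδ {k₁} {k₂} k₁≢k₂ {q₁} {q₂} q₁q₂-block
                        (a₁q₁ , q₁d₁) (a₂q₂ , q₂d₂) =
      e , e≉0 , q₁ , d₁ , q₁′ , d₁′ , q₁d₁ , t-walk-Pow fq₁ e , t-walk-Pow fd₁ e , q₁′d₁′
      where
        s₀ = r (α i₁) (α i)
        e = toℕ k₂ + -ₚ toℕ k₁
        e+k₁≈k₂ : e + toℕ k₁ ≈ toℕ k₂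
        e+k₁≈k₂ = ≈-trans (reflexive (+-comm e (toℕ k₁))) (m+[n-m]≈n (toℕ k₁) (toℕ k₂))
        e≉0 : e ≉ 0
        e≉0 e≈0 = k₁≢k₂ (toℕ-injective-≈ (≈-sym (≈-trans (≈-sym e+k₁≈k₂) (+-cong e≈0 ≈-refl))))
        a₁ = t-walk fa (toℕ k₁)
        a₂ = t-walk fa (toℕ k₂)
        d₁ = t-walk fδ (toℕ k₁)
        d₂ = t-walk fδ (toℕ k₂)
        fa₁ = t-walk-fib fa (toℕ k₁)
        fd₁ = t-walk-fib fδ (toℕ k₁)
        fq₁ = trans (r-fibʳ a₁q₁) (α-fib i)
        fq₂ = trans (r-fibʳ a₂q₂) (α-fib i)
        q₁′ = t-walk fq₁ e
        d₁′ = t-walk fd₁ e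
        a₁′ = t-walk fa₁ e
        a₁′≡a₂ : a₁′ ≡ a₂
        a₁′≡a₂ = Pow-unique (t-thin i₁) fa (Pow-trans (t-walk-Pow fa (toℕ k₁)) (t-walk-Pow fa₁ e))
                   (t-walk-Pow fa (toℕ k₂)) e+k₁≈k₂
        d₁′≡d₂ : d₁′ ≡ d₂
        d₁′≡d₂ = Pow-unique (t-thin j) fδ (Pow-trans (t-walk-Pow fδ (toℕ k₁)) (t-walk-Pow fd₁ e))
                   (t-walk-Pow fδ (toℕ k₂)) e+k₁≈k₂
        a₂q₁′ : r a₂ q₁′ ≡ s₀
        a₂q₁′ = subst (λ x → r x q₁′ ≡ s₀) a₁′≡a₂
                  (invariant-Pow (invariant-base i i≢i₁) fa₁ fq₁ a₁q₁ (t-walk-Pow fa₁ e) (t-walk-Pow fq₁ e))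
        q₂≡q₁′ : q₂ ≡ q₁′
        q₂≡q₁′ = successor-block-unique (λ e′ → i≢i₁ (trans (sym e′) (t-walk-fib fa (toℕ k₂)))) fq₂
                   (trans a₂q₁′ (sym a₂q₂))
                   (trans (sym q₁q₂-block) (Pow-block (t-thin i) fq₁ (t-walk-Pow fq₁ e)))
        q₁′d₁′ : r q₁′ d₁′ ≡ w
        q₁′d₁′ = subst₂ (λ x y → r x y ≡ w) q₂≡q₁′ (sym d₁′≡d₂) q₂d₂

    invariant-cross : ∀ i j → i ≢ i₁ → j ≢ i₁ → i ≢ j → Invariant i j
    invariant-cross i j i≢i₁ j≢i₁ i≢j w {β} {δ} fβ fδ βδ q q′ =
      let (a , fa , 2≤paths) = two-paths i≢i₁ fβ fδ (λ e → i≢j (sym e))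
          (k₁ , k₂ , k₁≢k₂ , q₁ , q₂ , q₁q₂-block , path₁ , path₂) =
            block-collision i≢i₁ j≢i₁ fa fδ 2≤paths
          (e , e≉0 , preserved-at) = collision⇒preserved i≢i₁ fa fδ k₁≢k₂ q₁q₂-block path₁ path₂
      in trans (preserves-generator e≉0 (preserved-at-some-pair⇒preserves preserved-at) fβ fδ refl q q′) βδ

    invariant : ∀ i j → i ≢ j → Invariant i j
    invariant i j i≢j with i ≟ i₁ | j ≟ i₁
    ... | yes refl | yes refl = ⊥-elim (i≢j refl)
    ... | yes refl | no j≢i₁ = invariant-base j j≢i₁
    ... | no i≢i₁ | yes refl = invariant-base-sym i i≢i₁
    ... | no i≢i₁ | no j≢i₁ = invariant-cross i j i≢i₁ j≢i₁ i≢j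

    t-shift≉0 : t i₁ ≢ r (α i₁) (α i₁) → ∀ i → shift i (t i) ≉ 0
    t-shift≉0 t₁≢1 i shift≈0 with i ≟ i₁
    ... | yes refl =
      t₁≢1 (trans (sym α₁γ₁) (cong (r (α i₁)) (zero-shift⇒identity (t-thin i₁) shift≈0 α₁γ₁)))
      where α₁γ₁ = proj₂ (thin-successor (t-thin i₁) (α-fib i₁))
    ... | no i≢i₁ =
      let (γ₁ , α₁γ₁) = thin-successor (t-thin i₁) (α-fib i₁)
          (δ , αᵢδ) = thin-successor (t-thin i) (α-fib i)
          γ₁αᵢ = subst (λ z → r γ₁ z ≡ r (α i₁) (α i)) (zero-shift⇒identity (t-thin i) shift≈0 αᵢδ)
                   (t-base i i≢i₁ γ₁ δ α₁γ₁ αᵢδ)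
          α₁≡γ₁ = predecessor-block-unique (α-fib i₁) (λ e → i≢i₁ (trans (sym (α-fib i)) e)) γ₁αᵢ
                    (thin⇒same-block (t-thin i₁) (α-fib i₁) α₁γ₁)
      in t₁≢1 (trans (sym α₁γ₁) (cong (r (α i₁)) (sym α₁≡γ₁)))

lemma3p9 :
    (p : ℕ) → Prime p →
    (N K : ℕ) (C : CoherentConfiguration N K) →
    let open CoherentConfiguration C using (r) in
    let open CC C in
    (m : ℕ) (F : Fibers m) →
    let open Fibers F using (fib) in
    let open FiberNotions F in
    -- (Ω_i, S_i) ≃ C_p ≀ C_p for each i
    (∀ i → IsoWr p i) →
    -- n_s = p for s ∈ S_ij, i ≠ j
    (∀ i j → i ≢ j → ∀ s → InS i j s → valency s p) →
    -- S = ⋃_i S_i ∪ (S ∖ R) : every regular element lies in some S_i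
    (∀ s → Regular s → ∃[ i ] InS i i s) →
    -- the distinguished fiber "1" and the points α_i ∈ Ω_i
    (i₁ : Fin m) (α : Fin m → Fin N) → (∀ i → fib (α i) ≡ i) →
    -- t_1 ∈ O_θ(S_1) ∖ {1_{Ω_1}} and t_i ∈ O_θ(S_i) with
    -- r(α_1 t_1, α_i t_i) = r(α_1, α_i) for i ≠ 1
    (t : Fin m → Fin K) → (∀ i → InO i (t i)) →
    t i₁ ≢ r (α i₁) (α i₁) →
    (∀ i → i ≢ i₁ → ∀ γ δ → r (α i₁) γ ≡ t i₁ → r (α i) δ ≡ t i →
       r γ δ ≡ r (α i₁) (α i)) →
    -- complete sets of representatives {α_ik | k} of ⋃_{t ∈ O_θ(S_i)} t
    (rep : Fin m → Fin p → Fin N) →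
    (∀ i k → fib (rep i k) ≡ i) →
    (∀ i β → fib β ≡ i →
       (∃[ k ] InOrbit i (rep i k) β) ×
       (∀ k k' → InOrbit i (rep i k) β → InOrbit i (rep i k') β → k ≡ k')) →
    -- conclusion: for s ∈ S_ij (i ≠ j), k, l, and h = h(s)_kl
    ∀ i j → i ≢ j → ∀ s → InS i j s → ∀ k l (h : Fin p) →
    (∃[ γ ] (Pow (t j) (toℕ h) (rep j l) γ × r (rep i k) γ ≡ s)) →
    ∀ β γ →
      ((r β γ ≡ s × InOrbit i (rep i k) β × InOrbit j (rep j l) γ) →
        Σ (Fin p) λ a → Σ (Fin p) λ b → (Pow (t i) (toℕ a) (rep i k) β ×
                                         Pow (t j) (toℕ b) (rep j l) γ ×
                                         toℕ b ≡[mod p ] (toℕ a + toℕ h)))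
      ×
      ((Σ (Fin p) λ a → Σ (Fin p) λ b → (Pow (t i) (toℕ a) (rep i k) β ×
                                         Pow (t j) (toℕ b) (rep j l) γ ×
                                         toℕ b ≡[mod p ] (toℕ a + toℕ h))) →
        (r β γ ≡ s × InOrbit i (rep i k) β × InOrbit j (rep j l) γ))
lemma3p9 p p-prime N K C m F iso cross-valency regular-homogeneous i₁ α α-fib t t-thin t₁≢1 t-base
         rep rep-fib _ i j i≢j s _ k l h (γₕ , γₕ-Pow , rep-γₕ) β γ =
  orbit-pair⇒coordinates , coordinates⇒orbit-pair
  where
    open Translations p p-prime C F iso cross-valency regular-homogeneous t t-thin
    open OrbitPairs i≢j (invariant i₁ α α-fib t-base i j i≢j) (t-shift≉0 i₁ α α-fib t-base t₁≢1 i)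
                    h (rep-fib i k) (rep-fib j l) γₕ-Pow rep-γₕ
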